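{- Let $T$ be a tree with order $p$ and diameter $d \ge 2$, let $\varepsilon = \varepsilon(T)$, let $f$ be a radio labeling of $T$ with $\min_v f(v)=0$, and order the vertices so that $0 = f(u_0) < f(u_1) < \cdots < f(u_{p-1})$. For $0 \le i \le p-2$ let $x_i = f(u_{i+1}) - f(u_i) + L(u_{i+1}) + L(u_i) - (d+\varepsilon)$. Then $x_i \ge 2\phi(u_i,u_{i+1})$, and hence $x_i \ge 0$, for all $0 \le i \le p-2$.
   Context: For a connected graph $G$, a radio labeling is a map $f: V(G) \to \{0,1,2,\ldots\}$ with $d(u,v) + |f(u)-f(v)| \ge \mathrm{diam}(G)+1$ for all distinct $u,v$ (so $f$ is injective). For a tree $T$ and $v \in V(T)$, let $w_T(v) = \sum_{u} d(u,v)$; a weight centre is a vertex minimizing $w_T$, and $W(T)$ is the set of weight centres; a tree has one weight centre or two adjacent weight centres. $\varepsilon(T) = 1$ if $|W(T)|=1$ and $0$ if $|W(T)|=2$. The level of $u$ is $L(u) = \min\{d(u,x): x \in W(T)\}$. View $T$ as rooted at $W(T)$ (both weight centres at level 0 if there are two): a vertex $u$ is an ancestor of $v$ if the unique path from a weight centre to $v$ passes through $u$ (possibly $u=v$); weight centres count as common ancestors of all vertices. Define $\phi(u,v) = \max\{L(x): x \text{ a common ancestor of } u \text{ and } v\}$ (so $\phi(u,v)=0$ exactly when $u,v$ lie in different subtrees hanging off the weight centre(s) or one of them is a weight centre). -}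

module Defs where

open import Data.Nat using (ℕ; zero; suc; _+_; _*_; _≤_; _<_; _≤?_; _≡ᵇ_; ∣_-_∣)
open import Data.Nat.Properties using (≤-trans; n≤1+n)
open import Data.Fin using (Fin; fromℕ<)
open import Data.Fin.Properties using (all?)
open import Data.List using (List; []; _∷_; map; length; filter)
open import Data.Nat.ListAction using (sum)
open import Data.List.Relation.Unary.Unique.Propositional using (Unique)
open import Data.List.Membership.Propositional using (_∈_)
open import Data.Product using (Σ; ∃; _×_; _,_)
open import Data.Bool using (if_then_else_)
open import Relation.Nullary using (¬_)
open import Relation.Unary using (Decidable)
open import Relation.Binary.PropositionalEquality using (_≡_)
open import Data.List using (allFin) public

IsSimpleGraph : ∀ {p} → (Fin p → Fin p → Set) → Set
IsSimpleGraph E = (∀ u v → E u v → E v u) × (∀ v → ¬ E v v)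

data Walk {p} (E : Fin p → Fin p → Set) : Fin p → Fin p → Set where
  [_]    : ∀ v → Walk E v v
  _∷⟨_⟩_ : ∀ u {w v} → E u w → Walk E w v → Walk E u v

verts : ∀ {p} {E : Fin p → Fin p → Set} {u v} → Walk E u v → List (Fin p)
verts [ v ] = v ∷ []
verts (u ∷⟨ _ ⟩ w) = u ∷ verts w

len : ∀ {p} {E : Fin p → Fin p → Set} {u v} → Walk E u v → ℕ
len [ v ] = 0
len (u ∷⟨ _ ⟩ w) = suc (len w)

IsPath : ∀ {p} {E : Fin p → Fin p → Set} {u v} → Walk E u v → Set
IsPath w = Unique (verts w)

IsTree : ∀ {p} → (Fin p → Fin p → Set) → Set
IsTree E = (∀ u v → Walk E u v)
         × (∀ {u v} (w₁ w₂ : Walk E u v) → IsPath w₁ → IsPath w₂ → verts w₁ ≡ verts w₂)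

Dist : ∀ {p} → (Fin p → Fin p → Set) → Fin p → Fin p → ℕ → Set
Dist E u v k = Σ (Walk E u v) (λ w → len w ≡ k) × (∀ (w : Walk E u v) → k ≤ len w)

IsDistance : ∀ {p} → (Fin p → Fin p → Set) → (Fin p → Fin p → ℕ) → Set
IsDistance E d = ∀ u v → Dist E u v (d u v)

IsDiameter : ∀ {p} → (Fin p → Fin p → ℕ) → ℕ → Set
IsDiameter d D = (∀ u v → d u v ≤ D) × ∃ (λ u → ∃ (λ v → d u v ≡ D))

IsRadioLabeling : ∀ {p} → (Fin p → Fin p → ℕ) → ℕ → (Fin p → ℕ) → Set
IsRadioLabeling d D f = ∀ u v → ¬ u ≡ v → D + 1 ≤ d u v + ∣ f u - f v ∣

weight : ∀ {p} → (Fin p → Fin p → ℕ) → Fin p → ℕ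
weight {p} d v = sum (map (λ u → d u v) (allFin p))

IsCentre : ∀ {p} → (Fin p → Fin p → ℕ) → Fin p → Set
IsCentre d v = ∀ u → weight d v ≤ weight d u

isCentre? : ∀ {p} (d : Fin p → Fin p → ℕ) → Decidable (IsCentre d)
isCentre? d v = all? (λ u → weight d v ≤? weight d u)

numCentres : ∀ {p} → (Fin p → Fin p → ℕ) → ℕ
numCentres {p} d = length (filter (isCentre? d) (allFin p))

epsilon : ∀ {p} → (Fin p → Fin p → ℕ) → ℕ
epsilon d = if numCentres d ≡ᵇ 1 then 1 else 0

IsLevel : ∀ {p} → (Fin p → Fin p → ℕ) → Fin p → ℕ → Set
IsLevel d v k = ∃ (λ x → IsCentre d x × d v x ≡ k)
              × (∀ y → IsCentre d y → k ≤ d v y)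

IsAncestor : ∀ {p} → (Fin p → Fin p → Set) → (Fin p → Fin p → ℕ) → Fin p → Fin p → Set
IsAncestor E d a v = ∃ (λ x → IsCentre d x × Σ (Walk E x v) (λ w → IsPath w × a ∈ verts w))

IsCommonAncestor : ∀ {p} → (Fin p → Fin p → Set) → (Fin p → Fin p → ℕ) → Fin p → Fin p → Fin p → Set
IsCommonAncestor E d a u v = IsAncestor E d a u × IsAncestor E d a v

IsPhi : ∀ {p} → (Fin p → Fin p → Set) → (Fin p → Fin p → ℕ) → (Fin p → ℕ) → Fin p → Fin p → ℕ → Set
IsPhi E d L u v k = ∃ (λ a → IsCommonAncestor E d a u v × L a ≡ k)
                  × (∀ b → IsCommonAncestor E d b u v → L b ≤ k)

ixL : ∀ {p} (i : ℕ) → suc i < p → Fin p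
ixL i h = fromℕ< (≤-trans (n≤1+n (suc i)) h)

ixR : ∀ {p} (i : ℕ) → suc i < p → Fin p
ixR i h = fromℕ< h

-- Two weight centres of a tree are at distance at most 1, and equal when ε = 1: if centres x, y
-- were at distance n + 1 ≥ 2, the neighbour z of x towards y would satisfy
-- (n + 1) d(t, z) ≤ n d(t, x) + d(t, y) for every t, strictly at t = z, and summing over t gives
-- (n + 1) w(z) < n w(x) + w(y), contradicting minimality. Hence, through the nearest centres,
-- d(u, v) + ε ≤ L(u) + L(v) + 1. If φ(u, v) ≥ 1, the common ancestor a of level φ is not a
-- centre, so the path from u to any centre passes through a; hence L(u) ≥ d(a, u) + φ and
-- L(v) ≥ d(a, v) + φ; as d(u, v) ≤ d(a, u) + d(a, v) we get in all cases
-- d(u, v) + 2φ + ε ≤ L(u) + L(v) + 1. Adding the radio condition D + 1 ≤ d(u, v) + f(v) − f(u)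
-- for consecutive labels gives x_i ≥ 2φ.
module Submission where

open import Defs
open import Data.Nat using (ℕ; suc; _+_; _*_; _≤_; _<_)
open import Data.Fin using (Fin) renaming (_<_ to _<ᶠ_)
open import Data.Integer using (ℤ; +_; _-_) renaming (_+_ to _+ℤ_; _≤_ to _≤ℤ_)
open import Data.Product using (∃; _×_)
open import Relation.Binary.PropositionalEquality using (_≡_)

open import Data.Nat using (zero; z≤n; s≤s; _≤?_; _≡ᵇ_; ∣_-_∣)
open import Data.Nat.Properties
open import Data.Nat.ListAction using (sum)
open import Data.Nat.Tactic.RingSolver using (solve-∀)
open import Data.Integer using (+≤+)
import Data.Integer.Properties as ℤ
import Data.Integer.Tactic.RingSolver as ℤ-Solver
open import Data.Fin using () renaming (_≟_ to _≟ᶠ_)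
open import Data.Fin.Properties using (toℕ-fromℕ<)
open import Data.List using (List; []; _∷_; _++_; map; length; filter; allFin)
open import Data.List.Membership.Propositional using (_∈_)
open import Data.List.Membership.Propositional.Properties using (∈-allFin; ∈-filter⁺)
open import Data.List.Relation.Unary.Any using (here; there)
open import Data.List.Relation.Unary.All using ([]; _∷_)
open import Data.List.Relation.Unary.All.Properties using (¬Any⇒All¬)
open import Data.List.Relation.Unary.AllPairs using ([]; _∷_)
open import Data.List.Relation.Unary.Unique.Propositional using (Unique)
open import Data.List.Relation.Unary.Unique.Propositional.Properties using (++⁺)
open import Data.List.Relation.Binary.Disjoint.Propositional using (Disjoint)
open import Data.Product using (Σ; _,_; proj₁; proj₂)
open import Data.Sum using (_⊎_; inj₁; inj₂)
open import Data.Bool using (true; false; T)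
open import Data.Unit using (tt)
open import Relation.Nullary using (yes; no; contradiction)
open import Relation.Unary using (Pred; Decidable)
open import Relation.Binary.PropositionalEquality using (refl; sym; trans; cong; cong₂; subst; subst₂; module ≡-Reasoning)

module _ {a} {A : Set a} where

  sum-map-+ : ∀ (g h : A → ℕ) xs → sum (map (λ t → g t + h t) xs) ≡ sum (map g xs) + sum (map h xs)
  sum-map-+ g h [] = refl
  sum-map-+ g h (t ∷ xs) = trans (cong (_+_ (g t + h t)) (sum-map-+ g h xs)) (interchange (g t) (h t) _ _)
    where
    interchange : ∀ a b c e → a + b + (c + e) ≡ a + c + (b + e)
    interchange = solve-∀

  sum-map-* : ∀ c (g : A → ℕ) xs → sum (map (λ t → c * g t) xs) ≡ c * sum (map g xs)
  sum-map-* c g [] = sym (*-zeroʳ c)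
  sum-map-* c g (t ∷ xs) = trans (cong (_+_ (c * g t)) (sum-map-* c g xs)) (sym (*-distribˡ-+ c (g t) _))

  sum-map-mono-≤ : ∀ {g h : A → ℕ} → (∀ t → g t ≤ h t) → ∀ xs → sum (map g xs) ≤ sum (map h xs)
  sum-map-mono-≤ g≤h [] = z≤n
  sum-map-mono-≤ g≤h (t ∷ xs) = +-mono-≤ (g≤h t) (sum-map-mono-≤ g≤h xs)

  sum-map-mono-< : ∀ {g h : A → ℕ} → (∀ t → g t ≤ h t) → ∀ {z} xs → z ∈ xs → g z < h z →
                   sum (map g xs) < sum (map h xs)
  sum-map-mono-< g≤h (t ∷ xs) (here refl) gz<hz = +-mono-<-≤ gz<hz (sum-map-mono-≤ g≤h xs)
  sum-map-mono-< g≤h (t ∷ xs) (there z∈xs) gz<hz = +-mono-≤-< (g≤h t) (sum-map-mono-< g≤h xs z∈xs gz<hz)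

filter-length≡1⇒≡ : ∀ {a ℓ} {A : Set a} {P : Pred A ℓ} (P? : Decidable P) (xs : List A) →
                    length (filter P? xs) ≡ 1 → ∀ {x y} → x ∈ xs → P x → y ∈ xs → P y → x ≡ y
filter-length≡1⇒≡ P? xs one x∈xs px y∈xs py
  with filter P? xs | one | ∈-filter⁺ P? x∈xs px | ∈-filter⁺ P? y∈xs py
... | _ ∷ [] | _ | here refl | here refl = refl

radio-rearrange : ∀ D δ g k ε a b x y → D + 1 ≤ δ + g → δ + k + ε ≤ a + b + 1 → x + g ≡ y →
                  x + (D + ε) + k ≤ y + b + a
radio-rearrange D δ g k ε a b x y radio δ-bound x+g≡y = +-cancelʳ-≤ (δ + 1) _ _ (begin
  x + (D + ε) + k + (δ + 1)     ≡⟨ regroup₁ x D ε k δ ⟩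
  x + ((D + 1) + (δ + k + ε))   ≤⟨ +-monoʳ-≤ x (+-mono-≤ radio δ-bound) ⟩
  x + ((δ + g) + (a + b + 1))   ≡⟨ regroup₂ x δ g a b ⟩
  x + g + b + a + (δ + 1)       ≡⟨ cong (λ m → m + b + a + (δ + 1)) x+g≡y ⟩
  y + b + a + (δ + 1)           ∎)
  where
  open ≤-Reasoning
  regroup₁ : ∀ x D ε k δ → x + (D + ε) + k + (δ + 1) ≡ x + ((D + 1) + (δ + k + ε))
  regroup₁ = solve-∀
  regroup₂ : ∀ x δ g a b → x + ((δ + g) + (a + b + 1)) ≡ x + g + b + a + (δ + 1)
  regroup₂ = solve-∀

ℕ≤⇒ℤ≤ : ∀ a b c x e m → x + e + m ≤ a + b + c → + m ≤ℤ (+ a - + x) +ℤ + b +ℤ + c - + e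
ℕ≤⇒ℤ≤ a b c x e m le with m≤n⇒∃[o]m+o≡n le
... | o , x+e+m+o≡a+b+c = ℤ.≤-trans (+≤+ (m≤m+n m o)) (ℤ.≤-reflexive (begin
  + (m + o)                               ≡⟨ regroup₁ (+ x) (+ e) (+ (m + o)) ⟩
  (+ x +ℤ + e +ℤ + (m + o)) - + x - + e   ≡⟨ cong (λ z → z - + x - + e) sums ⟩
  (+ a +ℤ + b +ℤ + c) - + x - + e         ≡⟨ regroup₂ (+ a) (+ b) (+ c) (+ x) (+ e) ⟩
  (+ a - + x) +ℤ + b +ℤ + c - + e         ∎))
  where
  open ≡-Reasoning
  embed : ∀ a b c → + (a + b + c) ≡ + a +ℤ + b +ℤ + c
  embed a b c = trans (ℤ.pos-+ (a + b) c) (cong (_+ℤ + c) (ℤ.pos-+ a b))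
  sums : + x +ℤ + e +ℤ + (m + o) ≡ + a +ℤ + b +ℤ + c
  sums = trans (sym (embed x e (m + o)))
           (trans (cong +_ (trans (sym (+-assoc (x + e) m o)) x+e+m+o≡a+b+c)) (embed a b c))
  regroup₁ : ∀ X E M → M ≡ (X +ℤ E +ℤ M) - X - E
  regroup₁ = ℤ-Solver.solve-∀
  regroup₂ : ∀ A B C X E → (A +ℤ B +ℤ C) - X - E ≡ (A - X) +ℤ B +ℤ C - E
  regroup₂ = ℤ-Solver.solve-∀

module _ {p} {E : Fin p → Fin p → Set} where

  open import Data.List.Membership.DecPropositional (_≟ᶠ_ {p}) using (_∈?_)

  infixr 5 _++ʷ_ _++⟨_⟩_

  _++ʷ_ : ∀ {s a t} → Walk E s a → Walk E a t → Walk E s t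
  [ _ ] ++ʷ w = w
  (u ∷⟨ e ⟩ w₁) ++ʷ w₂ = u ∷⟨ e ⟩ (w₁ ++ʷ w₂)

  len-++ʷ : ∀ {s a t} (w₁ : Walk E s a) (w₂ : Walk E a t) → len (w₁ ++ʷ w₂) ≡ len w₁ + len w₂
  len-++ʷ [ _ ] w = refl
  len-++ʷ (u ∷⟨ e ⟩ w₁) w₂ = cong suc (len-++ʷ w₁ w₂)

  _++⟨_⟩_ : ∀ {s x z t} → Walk E s x → E x z → Walk E z t → Walk E s t
  [ x ] ++⟨ e ⟩ w = x ∷⟨ e ⟩ w
  (u ∷⟨ e′ ⟩ w₁) ++⟨ e ⟩ w₂ = u ∷⟨ e′ ⟩ (w₁ ++⟨ e ⟩ w₂)

  verts-++⟨⟩ : ∀ {s x z t} (w₁ : Walk E s x) (e : E x z) (w₂ : Walk E z t) →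
               verts (w₁ ++⟨ e ⟩ w₂) ≡ verts w₁ ++ verts w₂
  verts-++⟨⟩ [ x ] e w = refl
  verts-++⟨⟩ (u ∷⟨ e′ ⟩ w₁) e w₂ = cong (u ∷_) (verts-++⟨⟩ w₁ e w₂)

  len-++⟨⟩ : ∀ {s x z t} (w₁ : Walk E s x) (e : E x z) (w₂ : Walk E z t) →
             len (w₁ ++⟨ e ⟩ w₂) ≡ suc (len w₁ + len w₂)
  len-++⟨⟩ [ x ] e w = refl
  len-++⟨⟩ (u ∷⟨ e′ ⟩ w₁) e w₂ = cong suc (len-++⟨⟩ w₁ e w₂)

  ++⟨⟩-isPath : ∀ {s x z t} (P : Walk E s x) (e : E x z) (Q : Walk E z t) →
                IsPath P → IsPath Q → Disjoint (verts P) (verts Q) → IsPath (P ++⟨ e ⟩ Q)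
  ++⟨⟩-isPath P e Q pP pQ disjoint = subst Unique (sym (verts-++⟨⟩ P e Q)) (++⁺ pP pQ disjoint)

  length-verts : ∀ {s t} (w : Walk E s t) → length (verts w) ≡ suc (len w)
  length-verts [ v ] = refl
  length-verts (u ∷⟨ e ⟩ w) = cong suc (length-verts w)

  splitAt : ∀ {s t a} (w : Walk E s t) → a ∈ verts w →
            Σ (Walk E s a) λ w₁ → Σ (Walk E a t) λ w₂ → len w₁ + len w₂ ≡ len w × (IsPath w → IsPath w₂)
  splitAt [ v ] (here refl) = [ v ] , [ v ] , refl , (λ pw → pw)
  splitAt (u ∷⟨ e ⟩ w) (here refl) = [ u ] , (u ∷⟨ e ⟩ w) , refl , (λ pw → pw)
  splitAt (u ∷⟨ e ⟩ w) (there a∈w) with splitAt w a∈w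
  ... | w₁ , w₂ , len≡ , suffix = (u ∷⟨ e ⟩ w₁) , w₂ , cong suc len≡ , λ { (_ ∷ pw) → suffix pw }

  toPath : ∀ {s t} (w : Walk E s t) → Σ (Walk E s t) λ P → IsPath P × len P ≤ len w
  toPath [ v ] = [ v ] , [] ∷ [] , z≤n
  toPath (u ∷⟨ e ⟩ w) with toPath w
  ... | P , pP , P≤w with u ∈? verts P
  ...   | no u∉P = (u ∷⟨ e ⟩ P) , ¬Any⇒All¬ _ u∉P ∷ pP , s≤s P≤w
  ...   | yes u∈P with splitAt P u∈P
  ...     | P₁ , P₂ , len≡ , suffix =
            P₂ , suffix pP , ≤-trans (m≤n+m (len P₂) (len P₁)) (≤-trans (≤-reflexive len≡) (m≤n⇒m≤1+n P≤w))

  reverseʷ : (∀ u v → E u v → E v u) → ∀ {s t} → Walk E s t → Walk E t s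
  reverseʷ E-sym [ v ] = [ v ]
  reverseʷ E-sym (u ∷⟨ e ⟩ w) = reverseʷ E-sym w ++⟨ E-sym u _ e ⟩ [ u ]

  len-reverseʷ : ∀ E-sym {s t} (w : Walk E s t) → len (reverseʷ E-sym w) ≡ len w
  len-reverseʷ E-sym [ v ] = refl
  len-reverseʷ E-sym (u ∷⟨ e ⟩ w) =
    trans (len-++⟨⟩ (reverseʷ E-sym w) _ [ u ]) (cong suc (trans (+-identityʳ _) (len-reverseʷ E-sym w)))

module GraphDistance {p} {E : Fin p → Fin p → Set} (simple : IsSimpleGraph E)
                     {d : Fin p → Fin p → ℕ} (distance : IsDistance E d) where

  open ≤-Reasoning

  E-sym : ∀ u v → E u v → E v u
  E-sym = proj₁ simple

  d≤len : ∀ {s t} (w : Walk E s t) → d s t ≤ len w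
  d≤len w = proj₂ (distance _ _) w

  geodesic : ∀ s t → Σ (Walk E s t) λ w → len w ≡ d s t
  geodesic s t = proj₁ (distance s t)

  d-refl : ∀ s → d s s ≡ 0
  d-refl s = n≤0⇒n≡0 (d≤len [ s ])

  d-sym : ∀ s t → d s t ≡ d t s
  d-sym s t = ≤-antisym (d≤d-flip s t) (d≤d-flip t s)
    where
    d≤d-flip : ∀ s t → d s t ≤ d t s
    d≤d-flip s t with geodesic t s
    ... | w , w≡d = subst (d s t ≤_) (trans (len-reverseʷ E-sym w) w≡d) (d≤len (reverseʷ E-sym w))

  d-triangle : ∀ s a t → d s t ≤ d s a + d a t
  d-triangle s a t with geodesic s a | geodesic a t
  ... | w₁ , w₁≡d | w₂ , w₂≡d = begin
    d s t               ≤⟨ d≤len (w₁ ++ʷ w₂) ⟩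
    len (w₁ ++ʷ w₂)     ≡⟨ len-++ʷ w₁ w₂ ⟩
    len w₁ + len w₂     ≡⟨ cong₂ _+_ w₁≡d w₂≡d ⟩
    d s a + d a t       ∎

  d≡0⇒≡ : ∀ {s t} → d s t ≡ 0 → s ≡ t
  d≡0⇒≡ {s} {t} s-t≡0 with geodesic s t
  ... | [ _ ] , _ = refl
  ... | (_ ∷⟨ _ ⟩ _) , w≡d = contradiction (trans w≡d s-t≡0) λ ()

  d≡1⇒E : ∀ {s t} → d s t ≡ 1 → E s t
  d≡1⇒E {s} {t} s-t≡1 with geodesic s t
  ... | [ _ ] , w≡d = contradiction (trans w≡d s-t≡1) λ ()
  ... | (_ ∷⟨ e ⟩ [ _ ]) , _ = e
  ... | (_ ∷⟨ _ ⟩ (_ ∷⟨ _ ⟩ _)) , w≡d = contradiction (trans w≡d s-t≡1) λ ()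

  E⇒d≡1 : ∀ {s t} → E s t → d s t ≡ 1
  E⇒d≡1 {s} {t} e = ≤-antisym (d≤len (s ∷⟨ e ⟩ [ t ]))
    (n≢0⇒n>0 λ s-t≡0 → proj₂ simple s (subst (E s) (sym (d≡0⇒≡ s-t≡0)) e))

module Tree {p} {E : Fin p → Fin p → Set} (simple : IsSimpleGraph E) (tree : IsTree E)
            {d : Fin p → Fin p → ℕ} (distance : IsDistance E d) where

  open GraphDistance simple distance
  open import Data.List.Membership.DecPropositional (_≟ᶠ_ {p}) using (_∈?_)

  paths-same-len : ∀ {s t} (P Q : Walk E s t) → IsPath P → IsPath Q → len P ≡ len Q
  paths-same-len P Q pP pQ =
    suc-injective (trans (sym (length-verts P)) (trans (cong length (proj₂ tree P Q pP pQ)) (length-verts Q)))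

  path⇒geodesic : ∀ {s t} (P : Walk E s t) → IsPath P → len P ≡ d s t
  path⇒geodesic {s} {t} P pP with geodesic s t
  ... | w , w≡d with toPath w
  ...   | Q , pQ , Q≤w = ≤-antisym P≤d (d≤len P)
    where
    open ≤-Reasoning
    P≤d : len P ≤ d s t
    P≤d = begin
      len P ≡⟨ paths-same-len P Q pP pQ ⟩
      len Q ≤⟨ Q≤w ⟩
      len w ≡⟨ w≡d ⟩
      d s t ∎

  geodesic-path : ∀ s t → Σ (Walk E s t) λ P → IsPath P × len P ≡ d s t
  geodesic-path s t with toPath (proj₁ (geodesic s t))
  ... | P , pP , _ = P , pP , path⇒geodesic P pP

  d-split : ∀ {s t a} (P : Walk E s t) → IsPath P → a ∈ verts P → d s t ≡ d s a + d a t
  d-split {s} {t} {a} P pP a∈P with splitAt P a∈P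
  ... | P₁ , P₂ , len≡ , _ = ≤-antisym (d-triangle s a t) (begin
    d s a + d a t     ≤⟨ +-mono-≤ (d≤len P₁) (d≤len P₂) ⟩
    len P₁ + len P₂   ≡⟨ len≡ ⟩
    len P             ≡⟨ path⇒geodesic P pP ⟩
    d s t             ∎)
    where open ≤-Reasoning

  d-across-edge : ∀ {x z} → E x z → ∀ t → d t z ≡ suc (d t x) ⊎ d t x ≡ suc (d t z)
  d-across-edge {x} {z} e t with geodesic-path t x
  ... | P , pP , P≡d with z ∈? verts P
  ...   | yes z∈P = inj₂ (begin
    d t x         ≡⟨ d-split P pP z∈P ⟩
    d t z + d z x ≡⟨ cong (_+_ (d t z)) (E⇒d≡1 (E-sym x z e)) ⟩
    d t z + 1     ≡⟨ +-comm (d t z) 1 ⟩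
    suc (d t z)   ∎)
    where open ≡-Reasoning
  ...   | no z∉P = inj₁ (begin
    d t z                   ≡⟨ sym (path⇒geodesic (P ++⟨ e ⟩ [ z ]) (++⟨⟩-isPath P e [ z ] pP ([] ∷ []) disjoint)) ⟩
    len (P ++⟨ e ⟩ [ z ])   ≡⟨ len-++⟨⟩ P e [ z ] ⟩
    suc (len P + 0)         ≡⟨ cong suc (trans (+-identityʳ (len P)) P≡d) ⟩
    suc (d t x)             ∎)
    where
    open ≡-Reasoning
    disjoint : Disjoint (verts P) (z ∷ [])
    disjoint (r∈P , here refl) = z∉P r∈P

  farther-from-between : ∀ {x z t r} → E x z → d t z ≡ suc (d t x) → d t x ≡ d t r + d r x →
                         d r z ≡ suc (d r x)
  farther-from-between {x} {z} {t} {r} e tz between with d-across-edge e r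
  ... | inj₁ rz = rz
  ... | inj₂ rx = contradiction chain (<-irrefl refl)
    where
    open ≤-Reasoning
    chain : suc (d t x) < suc (d t x)
    chain = begin-strict
      suc (d t x)         ≡⟨ sym tz ⟩
      d t z               ≤⟨ d-triangle t r z ⟩
      d t r + d r z       <⟨ +-monoʳ-< (d t r) (n<1+n (d r z)) ⟩
      d t r + suc (d r z) ≡⟨ cong (_+_ (d t r)) (sym rx) ⟩
      d t r + d r x       ≡⟨ sym between ⟩
      d t x               <⟨ n<1+n (d t x) ⟩
      suc (d t x)         ∎

  d-via-edge : ∀ {x z t s} → E x z → d t z ≡ suc (d t x) → d s x ≡ suc (d s z) →
               d t s ≡ d t x + suc (d z s)
  d-via-edge {x} {z} {t} {s} e tz sx with geodesic-path t x | geodesic-path z s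
  ... | P , pP , P≡d | Q , pQ , Q≡d = begin
    d t s                   ≡⟨ sym (path⇒geodesic (P ++⟨ e ⟩ Q) (++⟨⟩-isPath P e Q pP pQ disjoint)) ⟩
    len (P ++⟨ e ⟩ Q)       ≡⟨ len-++⟨⟩ P e Q ⟩
    suc (len P + len Q)     ≡⟨ cong₂ (λ m n → suc (m + n)) P≡d Q≡d ⟩
    suc (d t x + d z s)     ≡⟨ sym (+-suc (d t x) (d z s)) ⟩
    d t x + suc (d z s)     ∎
    where
    open ≡-Reasoning
    disjoint : Disjoint (verts P) (verts Q)
    disjoint {r} (r∈P , r∈Q) = m≢1+n+m (d r z) {1} (trans rz (cong suc rx))
      where
      between-s-z : d s z ≡ d s r + d r z
      between-s-z = begin
        d s z         ≡⟨ d-sym s z ⟩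
        d z s         ≡⟨ d-split Q pQ r∈Q ⟩
        d z r + d r s ≡⟨ +-comm (d z r) (d r s) ⟩
        d r s + d z r ≡⟨ cong₂ _+_ (d-sym r s) (d-sym z r) ⟩
        d s r + d r z ∎
      rz : d r z ≡ suc (d r x)
      rz = farther-from-between e tz (d-split P pP r∈P)
      rx : d r x ≡ suc (d r z)
      rx = farther-from-between (E-sym x z e) sx between-s-z

  d-convex : ∀ {x z y n} → E x z → d x y ≡ suc n → d z y ≡ n → ∀ t → suc n * d t z ≤ n * d t x + d t y
  d-convex {x} {z} {y} {n} e xy zy t with d-across-edge e t
  ... | inj₁ tz = ≤-reflexive (begin
    suc n * d t z               ≡⟨ cong (suc n *_) tz ⟩
    suc n * suc (d t x)         ≡⟨ expand n (d t x) ⟩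
    n * d t x + (d t x + suc n) ≡⟨ cong (_+_ (n * d t x)) (sym ty) ⟩
    n * d t x + d t y           ∎)
    where
    open ≡-Reasoning
    expand : ∀ n a → suc n * suc a ≡ n * a + (a + suc n)
    expand = solve-∀
    yx : d y x ≡ suc (d y z)
    yx = trans (d-sym y x) (trans xy (cong suc (trans (sym zy) (d-sym z y))))
    ty : d t y ≡ d t x + suc n
    ty = trans (d-via-edge e tz yx) (cong (λ m → d t x + suc m) zy)
  ... | inj₂ tx = begin
    suc n * d t z           ≡⟨⟩
    d t z + n * d t z       ≤⟨ +-monoˡ-≤ (n * d t z) tz≤ty+n ⟩
    d t y + n + n * d t z   ≡⟨ regroup (d t y) n (d t z) ⟩
    n * suc (d t z) + d t y ≡⟨ cong (λ m → n * m + d t y) (sym tx) ⟩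
    n * d t x + d t y       ∎
    where
    open ≤-Reasoning
    regroup : ∀ c n b → c + n + n * b ≡ n * suc b + c
    regroup = solve-∀
    tz≤ty+n : d t z ≤ d t y + n
    tz≤ty+n = ≤-trans (d-triangle t y z) (≤-reflexive (cong (_+_ (d t y)) (trans (d-sym y z) zy)))

  weight-convex : ∀ {x z y n} → E x z → d x y ≡ suc n → d z y ≡ n → 1 ≤ n →
                  suc n * weight d z < n * weight d x + weight d y
  weight-convex {x} {z} {y} {n} e xy zy 1≤n = begin-strict
    suc n * weight d z                            ≡⟨ sym (sum-map-* (suc n) (λ t → d t z) vs) ⟩
    sum (map (λ t → suc n * d t z) vs)            <⟨ sum-map-mono-< (d-convex e xy zy) vs (∈-allFin z) strict-at-z ⟩
    sum (map (λ t → n * d t x + d t y) vs)        ≡⟨ sum-map-+ (λ t → n * d t x) (λ t → d t y) vs ⟩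
    sum (map (λ t → n * d t x) vs) + weight d y   ≡⟨ cong (_+ weight d y) (sum-map-* n (λ t → d t x) vs) ⟩
    n * weight d x + weight d y                   ∎
    where
    open ≤-Reasoning
    vs = allFin p
    strict-at-z : suc n * d z z < n * d z x + d z y
    strict-at-z = begin-strict
      suc n * d z z     ≡⟨ cong (suc n *_) (d-refl z) ⟩
      suc n * 0         ≡⟨ *-zeroʳ (suc n) ⟩
      0                 <⟨ 1≤n ⟩
      n                 ≤⟨ m≤n+m n (n * d z x) ⟩
      n * d z x + n     ≡⟨ cong (_+_ (n * d z x)) (sym zy) ⟩
      n * d z x + d z y ∎

  centres-d≤1 : ∀ {x y} → IsCentre d x → IsCentre d y → d x y ≤ 1
  centres-d≤1 {x} {y} cx cy with d x y ≤? 1 | geodesic x y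
  ... | yes xy≤1 | _ = xy≤1
  ... | no xy≰1 | [ _ ] , w≡d = contradiction (subst (_≤ 1) w≡d z≤n) xy≰1
  ... | no xy≰1 | (_∷⟨_⟩_ _ {z} e w) , w≡d =
    contradiction (weight-convex e (sym w≡d) zy 1≤n) (≤⇒≯ centres-minimal)
    where
    open ≤-Reasoning
    n = len w
    1≤n : 1 ≤ n
    1≤n = ≤-pred (subst (2 ≤_) (sym w≡d) (≰⇒> xy≰1))
    zy : d z y ≡ n
    zy = ≤-antisym (d≤len w) (≤-pred (begin
      suc n         ≡⟨ w≡d ⟩
      d x y         ≤⟨ d-triangle x z y ⟩
      d x z + d z y ≡⟨ cong (_+ d z y) (E⇒d≡1 e) ⟩
      suc (d z y)   ∎))
    centres-minimal : n * weight d x + weight d y ≤ suc n * weight d z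
    centres-minimal = ≤-trans (+-mono-≤ (*-monoʳ-≤ n (cx z)) (cy z)) (≤-reflexive (+-comm _ (weight d z)))

  centres-adjacent : ∀ {x y} → IsCentre d x → IsCentre d y → x ≡ y ⊎ E x y
  centres-adjacent {x} {y} cx cy with d x y in xy | centres-d≤1 cx cy
  ... | 0 | _ = inj₁ (d≡0⇒≡ xy)
  ... | 1 | _ = inj₂ (d≡1⇒E xy)
  ... | suc (suc _) | s≤s ()

  centres-d+ε≤1 : ∀ {x y} → IsCentre d x → IsCentre d y → d x y + epsilon d ≤ 1
  centres-d+ε≤1 {x} {y} cx cy with numCentres d ≡ᵇ 1 in unique
  ... | false = ≤-trans (≤-reflexive (+-identityʳ (d x y))) (centres-d≤1 cx cy)
  ... | true = ≤-reflexive (cong (_+ 1) (trans (cong (d x) (sym x≡y)) (d-refl x)))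
    where
    x≡y : x ≡ y
    x≡y = filter-length≡1⇒≡ (isCentre? d) (allFin p) (≡ᵇ⇒≡ (numCentres d) 1 (subst T (sym unique) tt))
                            (∈-allFin x) cx (∈-allFin y) cy

  ancestor-bound : ∀ {x c U a ℓ} → IsCentre d x → IsCentre d c → (P : Walk E x U) → IsPath P → a ∈ verts P →
                   1 ≤ ℓ → (∀ y → IsCentre d y → ℓ ≤ d a y) → d a U + ℓ ≤ d U c
  ancestor-bound {x} {c} {U} {a} {ℓ} cx cc P pP a∈P 1≤ℓ ℓ≤ = bound (centres-adjacent cx cc)
    where
    open ≤-Reasoning
    U-a-x : d U x ≡ d a U + d a x
    U-a-x = trans (d-sym U x) (trans (d-split P pP a∈P)
              (trans (+-comm (d x a) (d a U)) (cong (_+_ (d a U)) (d-sym x a))))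
    via-x : ∀ m → m ≤ d a x → d a U + m ≤ d U x
    via-x m m≤ax = ≤-trans (+-monoʳ-≤ (d a U) m≤ax) (≤-reflexive (sym U-a-x))
    bound : x ≡ c ⊎ E x c → d a U + ℓ ≤ d U c
    bound (inj₁ refl) = via-x ℓ (ℓ≤ x cx)
    bound (inj₂ e) with d-across-edge e U
    ... | inj₁ Uc = ≤-trans (via-x ℓ (ℓ≤ x cx)) (≤-trans (n≤1+n (d U x)) (≤-reflexive (sym Uc)))
    ... | inj₂ Ux with d-across-edge e a
    ...   | inj₂ ax = ≤-pred (begin
      suc (d a U + ℓ) ≡⟨ sym (+-suc (d a U) ℓ) ⟩
      d a U + suc ℓ   ≤⟨ via-x (suc ℓ) (subst (suc ℓ ≤_) (sym ax) (s≤s (ℓ≤ c cc))) ⟩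
      d U x           ≡⟨ Ux ⟩
      suc (d U c)     ∎)
    -- d U x = 2 d a x + d U x here, so a would be the centre x itself, which 1 ≤ ℓ rules out.
    ...   | inj₁ ac = contradiction (≤-trans 1≤ℓ (ℓ≤ x cx)) λ 1≤ax → <-irrefl refl (begin-strict
      suc (d c U)                 <⟨ m<n+m (suc (d c U)) 1≤ax ⟩
      d a x + suc (d c U)         ≤⟨ m≤m+n _ (d a x) ⟩
      d a x + suc (d c U) + d a x ≡⟨ cong (_+ d a x) (sym (d-via-edge e ac Ux)) ⟩
      d a U + d a x               ≡⟨ sym U-a-x ⟩
      d U x                       ≡⟨ Ux ⟩
      suc (d U c)                 ≡⟨ cong suc (d-sym U c) ⟩
      suc (d c U)                 ∎)

  module _ {L : Fin p → ℕ} (level : ∀ v → IsLevel d v (L v)) where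

    open ≤-Reasoning

    nearest-centre : ∀ v → ∃ λ c → IsCentre d c × d v c ≡ L v
    nearest-centre v = proj₁ (level v)

    ancestor-d+L≤L : ∀ {a U} → IsAncestor E d a U → 1 ≤ L a → d a U + L a ≤ L U
    ancestor-d+L≤L {a} {U} (x , cx , P , pP , a∈P) 1≤La with nearest-centre U
    ... | c , cc , Uc≡LU = subst (d a U + L a ≤_) Uc≡LU (ancestor-bound cx cc P pP a∈P 1≤La (proj₂ (level a)))

    d+ε≤L+L+1 : ∀ U V → d U V + epsilon d ≤ L U + L V + 1
    d+ε≤L+L+1 U V with nearest-centre U | nearest-centre V
    ... | cU , ccU , UcU≡LU | cV , ccV , VcV≡LV = begin
      d U V + epsilon d                           ≤⟨ +-monoˡ-≤ (epsilon d) U-cU-cV-V ⟩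
      d U cU + (d cU cV + d cV V) + epsilon d     ≡⟨ regroup (d U cU) (d cU cV) (d cV V) (epsilon d) ⟩
      d U cU + d cV V + (d cU cV + epsilon d)     ≤⟨ +-monoʳ-≤ (d U cU + d cV V) (centres-d+ε≤1 ccU ccV) ⟩
      d U cU + d cV V + 1                         ≡⟨ cong₂ (λ m n → m + n + 1) UcU≡LU (trans (d-sym cV V) VcV≡LV) ⟩
      L U + L V + 1                               ∎
      where
      regroup : ∀ a b c e → a + (b + c) + e ≡ a + c + (b + e)
      regroup = solve-∀
      U-cU-cV-V : d U V ≤ d U cU + (d cU cV + d cV V)
      U-cU-cV-V = ≤-trans (d-triangle U cU V) (+-monoʳ-≤ (d U cU) (d-triangle cU cV V))

    common-ancestor-bound : ∀ {a U V} → IsCommonAncestor E d a U V → 1 ≤ L a →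
                            d U V + 2 * L a + epsilon d ≤ L U + L V + 1
    common-ancestor-bound {a} {U} {V} (ancU , ancV) 1≤La = begin
      d U V + 2 * L a + epsilon d             ≤⟨ +-mono-≤ (+-monoˡ-≤ (2 * L a) U-a-V) ε≤1 ⟩
      d a U + d a V + 2 * L a + 1             ≡⟨ regroup (d a U) (d a V) (L a) ⟩
      (d a U + L a) + (d a V + L a) + 1       ≤⟨ +-monoˡ-≤ 1 (+-mono-≤ (ancestor-d+L≤L ancU 1≤La) (ancestor-d+L≤L ancV 1≤La)) ⟩
      L U + L V + 1                           ∎
      where
      regroup : ∀ b c k → b + c + 2 * k + 1 ≡ (b + k) + (c + k) + 1
      regroup = solve-∀
      U-a-V : d U V ≤ d a U + d a V
      U-a-V = ≤-trans (d-triangle U a V) (≤-reflexive (cong (_+ d a V) (d-sym U a)))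
      ε≤1 : epsilon d ≤ 1
      ε≤1 with nearest-centre U
      ... | c , cc , _ = ≤-trans (m≤n+m (epsilon d) (d c c)) (centres-d+ε≤1 cc cc)

    d+2φ+ε≤L+L+1 : ∀ {U V k} → IsPhi E d L U V k → d U V + 2 * k + epsilon d ≤ L U + L V + 1
    d+2φ+ε≤L+L+1 {U} {V} {zero} _ =
      subst (λ m → m + epsilon d ≤ L U + L V + 1) (sym (+-identityʳ (d U V))) (d+ε≤L+L+1 U V)
    d+2φ+ε≤L+L+1 {U} {V} {suc k} ((a , common , La≡1+k) , _) =
      subst (λ m → d U V + 2 * m + epsilon d ≤ L U + L V + 1) La≡1+k
            (common-ancestor-bound common (subst (1 ≤_) (sym La≡1+k) (s≤s z≤n)))

lemma3p3 : ∀ {p} (E : Fin p → Fin p → Set) → IsSimpleGraph E → IsTree E →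
    (d : Fin p → Fin p → ℕ) → IsDistance E d →
    (D : ℕ) → IsDiameter d D → 2 ≤ D →
    (f : Fin p → ℕ) → IsRadioLabeling d D f → ∃ (λ v → f v ≡ 0) →
    (u : Fin p → Fin p) → (∀ i j → i <ᶠ j → f (u i) < f (u j)) →
    (L : Fin p → ℕ) → (∀ v → IsLevel d v (L v)) →
    ∀ (i : ℕ) (h : suc i < p) → ∀ (k : ℕ) →
    IsPhi E d L (u (ixL i h)) (u (ixR i h)) k →
    (+ (2 * k) ≤ℤ ((+ f (u (ixR i h)) - + f (u (ixL i h))) +ℤ + L (u (ixR i h)) +ℤ + L (u (ixL i h)) - + (D + epsilon d)))
    × (+ 0 ≤ℤ ((+ f (u (ixR i h)) - + f (u (ixL i h))) +ℤ + L (u (ixR i h)) +ℤ + L (u (ixL i h)) - + (D + epsilon d)))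
lemma3p3 E simple tree d distance D _ _ f radio _ u increasing L level i h k φ = x≥2φ , ℤ.≤-trans (+≤+ z≤n) x≥2φ
  where
  open Tree simple tree distance
  U = u (ixL i h)
  V = u (ixR i h)
  fU<fV : f U < f V
  fU<fV = increasing _ _ (subst₂ _<_ (sym (toℕ-fromℕ< _)) (sym (toℕ-fromℕ< h)) (n<1+n i))
  fU+gap≡fV : f U + ∣ f U - f V ∣ ≡ f V
  fU+gap≡fV = trans (cong (_+_ (f U)) (m≤n⇒∣m-n∣≡n∸m (<⇒≤ fU<fV))) (m+[n∸m]≡n (<⇒≤ fU<fV))
  x≥2φ-in-ℕ : f U + (D + epsilon d) + 2 * k ≤ f V + L V + L U
  x≥2φ-in-ℕ = radio-rearrange D (d U V) ∣ f U - f V ∣ (2 * k) (epsilon d) (L U) (L V) (f U) (f V)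
                 (radio U V (λ U≡V → <-irrefl (cong f U≡V) fU<fV)) (d+2φ+ε≤L+L+1 level φ) fU+gap≡fV
  x≥2φ : + (2 * k) ≤ℤ (+ f V - + f U) +ℤ + L V +ℤ + L U - + (D + epsilon d)
  x≥2φ = ℕ≤⇒ℤ≤ (f V) (L V) (L U) (f U) (D + epsilon d) (2 * k) x≥2φ-in-ℕ
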